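{- Work in the type theory with identity types and the $\mathsf{app}$-formulation of dependent products, extended by the rules $\Pi$-$\mathsf{Id}$-elim and $\Pi$-$\mathsf{Id}$-comp. Then the function extensionality rules $\Pi$-ext and $\Pi$-ext-comp are definable: for $m,n:\Pi(A,B)$ and $k:\Pi x:A.\,\mathsf{Id}_{B(x)}(m\cdot x,n\cdot x)$ one can define $\mathsf{ext}(m,n,k):\mathsf{Id}_{\Pi(A,B)}(m,n)$ with $\mathsf{ext}(\lambda f,\lambda f,\lambda(rf))=r(\lambda f)$ for every $f:(x:A)\,B(x)$.
   Context: Intensional Martin-Löf type theory presented in the Logical Framework (rules may have higher-order premises such as $f:(x:A)\,B(x)$, a meta-level function; we write $fx$ for $f(x)$, $\lambda f$ for $\lambda(f)$, and $rf$ for $[x:A]\,r(fx)$). A rule is definable if terms realising it, with its stated definitional equalities, can be constructed from the given rules. Identity types: $\mathsf{Id}_A(a,b)$, $r(a):\mathsf{Id}_A(a,a)$, eliminator $J$ with $J(d,a,a,r(a))=d(a)$. $\mathsf{app}$-formulation of $\Pi$: formation $\Pi(A,B)$; abstraction $\lambda(f):\Pi(A,B)$; application $m\cdot a:B(a)$; $\beta$: $\lambda(f)\cdot a=f(a)$. Write $\Pi x:A.\,B(x)$ for $\Pi(A,[x:A]\,B(x))$. $\Pi$-$\mathsf{Id}$-elim: given $u,v:\Pi(A,B),\ w:\Pi x:A.\,\mathsf{Id}_{B(x)}(u\cdot x,v\cdot x)\vdash C(u,v,w)\ \mathsf{type}$, $f:(x:A)\,B(x)\vdash d(f):C(\lambda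 f,\lambda f,\lambda(rf))$, $m,n:\Pi(A,B)$ and $k:\Pi x:A.\,\mathsf{Id}_{B(x)}(m\cdot x,n\cdot x)$, there is $L(d,m,n,k):C(m,n,k)$. $\Pi$-$\mathsf{Id}$-comp: for $h:(x:A)\,B(x)$, $L(d,\lambda h,\lambda h,\lambda(rh))=d(h)$. -}

module Defs where

open import Relation.Binary.PropositionalEquality using (_≡_)

-- A model of the object type theory: object types are Agda types (Set),
-- object-level identity types Id are abstract (NOT Agda's _≡_), and
-- object-level definitional equalities are rendered by the meta-level _≡_.
record PiIdTheory : Set₁ where
  field
    Id    : (A : Set) → A → A → Set
    r     : {A : Set} (a : A) → Id A a a
    J     : {A : Set} (C : (a b : A) → Id A a b → Set)
            (d : (a : A) → C a a (r a))
            (a b : A) (p : Id A a b) → C a b p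
    J-comp : {A : Set} (C : (a b : A) → Id A a b → Set)
             (d : (a : A) → C a a (r a)) (a : A) →
             J C d a a (r a) ≡ d a
    Pi    : (A : Set) → (A → Set) → Set
    lam   : {A : Set} {B : A → Set} → ((x : A) → B x) → Pi A B
    app   : {A : Set} {B : A → Set} → Pi A B → (a : A) → B a
    β     : {A : Set} {B : A → Set} (f : (x : A) → B x) (a : A) →
            app (lam f) a ≡ f a
  HtpyTy : {A : Set} {B : A → Set} → Pi A B → Pi A B → Set
  HtpyTy {A} {B} m n = Pi A (λ x → Id (B x) (app m x) (app n x))
  -- λ(rf), written λ([x] r(λf · x)) (definitionally equal to [x] r(f x)
  -- in the object theory by β) so that it has type HtpyTy (lam f) (lam f).
  reflH : {A : Set} {B : A → Set} (f : (x : A) → B x) → HtpyTy (lam f) (lam f)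
  reflH f = lam (λ x → r (app (lam f) x))
  field
    L     : {A : Set} {B : A → Set}
            (C : (u v : Pi A B) → HtpyTy u v → Set)
            (d : (f : (x : A) → B x) → C (lam f) (lam f) (reflH f))
            (m n : Pi A B) (k : HtpyTy m n) → C m n k
    L-comp : {A : Set} {B : A → Set}
             (C : (u v : Pi A B) → HtpyTy u v → Set)
             (d : (f : (x : A) → B x) → C (lam f) (lam f) (reflH f))
             (h : (x : A) → B x) →
             L C d (lam h) (lam h) (reflH h) ≡ d h

module Submission where

open import Defs
open import Data.Product using (Σ; _,_)
open import Relation.Binary.PropositionalEquality using (_≡_)

-- Π-Id-elim into the family C(u, v, w) := Id(u, v), which ignores the homotopy w.
module Extensionality (T : PiIdTheory) where
  open PiIdTheory T

  ext : {A : Set} {B : A → Set} (m n : Pi A B) → HtpyTy m n → Id (Pi A B) m n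
  ext {A} {B} = L (λ u v _ → Id (Pi A B) u v) (λ f → r (lam f))

  ext-comp : {A : Set} {B : A → Set} (f : (x : A) → B x) →
             ext (lam f) (lam f) (reflH f) ≡ r (lam f)
  ext-comp {A} {B} = L-comp (λ u v _ → Id (Pi A B) u v) (λ f → r (lam f))

proposition5p8 : (T : PiIdTheory) → let open PiIdTheory T in
    Σ ({A : Set} {B : A → Set} (m n : Pi A B) → HtpyTy m n → Id (Pi A B) m n)
      (λ ext → {A : Set} {B : A → Set} (f : (x : A) → B x) →
               ext (lam f) (lam f) (reflH f) ≡ r (lam f))
proposition5p8 T = ext , ext-comp
  where open Extensionality T
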